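{- Let $\mathbb F$ be a field, $a,b\in\mathbb F$ with $b\neq 0$, and $n\ge 0$ an integer. Then $\operatorname{rk_\mathsf S}\mathcal M_{n;a,b}\ge n$.
   Context: $\mathcal M_{n;a,b}\in\operatorname{Sym}^n(\mathbb F^2)$ is the symmetric tensor, viewed as a function $\{0,1\}^n\to\mathbb F$, which takes value $a$ on the all-zero input, value $b$ on every input of Hamming weight one, and $0$ on all other inputs ($\mathcal M_{0;a,b}$ is the constant $a$). For $v=(\alpha,\beta)\in\mathbb F^2$, $v^{\otimes n}$ is the function $(x_1,\dots,x_n)\mapsto\prod_i v_{x_i}$ with $v_0=\alpha$, $v_1=\beta$ ($v^{\otimes 0}=1$). The symmetric rank $\operatorname{rk_\mathsf S}A$ of $A\in\operatorname{Sym}^n(\mathbb F^2)$ is the least $r\ge 0$ such that $A=\sum_{i=1}^r\lambda_iv_i^{\otimes n}$ with $\lambda_i\in\mathbb F$, $v_i\in\mathbb F^2$ ($\infty$ if none exists). -}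

module Defs where

open import Level using (Level; _⊔_)
open import Data.Nat using (ℕ; zero; suc; _≤_)
open import Data.Bool using (Bool; true; false; if_then_else_)
open import Data.Vec using (Vec; []; _∷_)
open import Data.Fin using (Fin; zero; suc)
open import Data.Product using (_×_; _,_; proj₁; proj₂; Σ; ∃)
open import Relation.Nullary using (¬_)
open import Algebra.Bundles using (CommutativeRing)

record Field (c ℓ : Level) : Set (Level.suc (c ⊔ ℓ)) where
  field
    commutativeRing : CommutativeRing c ℓ
  open CommutativeRing commutativeRing public
  field
    0≉1     : ¬ (0# ≈ 1#)
    inverse : ∀ x → ¬ (x ≈ 0#) → Σ Carrier (λ y → x * y ≈ 1#)

weight : ∀ {n} → Vec Bool n → ℕ
weight []          = 0
weight (false ∷ x) = weight x
weight (true ∷ x)  = suc (weight x)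

module _ {c ℓ} (F : Field c ℓ) where
  open Field F using (Carrier; _≈_; _+_; _*_; 0#; 1#)

  -- Tensors in (F^2)^{⊗n}, viewed as functions {0,1}^n → F.
  Tensor : ℕ → Set c
  Tensor n = Vec Bool n → Carrier

  M : (n : ℕ) → Carrier → Carrier → Tensor n
  M n a b x with weight x
  ... | zero        = a
  ... | suc zero    = b
  ... | suc (suc _) = 0#

  tensorPow : (n : ℕ) → Carrier × Carrier → Tensor n
  tensorPow zero    v []      = 1#
  tensorPow (suc n) v (xi ∷ x) =
    (if xi then proj₂ v else proj₁ v) * tensorPow n v x

  ∑ : (r : ℕ) → (Fin r → Carrier) → Carrier
  ∑ zero    f = 0#
  ∑ (suc r) f = f zero + ∑ r (λ i → f (suc i))

  HasSymDecomp : (n : ℕ) → Tensor n → (r : ℕ) → Set (c ⊔ ℓ)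
  HasSymDecomp n A r =
    Σ (Fin r → Carrier) λ lam → Σ (Fin r → Carrier × Carrier) λ v →
      ∀ x → A x ≈ ∑ r (λ i → lam i * tensorPow n (v i) x)

  -- rk_S A ≥ k : every symmetric decomposition of A has length ≥ k
  -- (the least such length is ≥ k, or none exists, i.e. rank ∞).
  SymRankAtLeast : (n : ℕ) → Tensor n → ℕ → Set (c ⊔ ℓ)
  SymRankAtLeast n A k = ∀ r → HasSymDecomp n A r → k ≤ r

-- We show, by induction on r and for all n, a and all b ≠ 0, that a symmetric
-- decomposition  M_{n;a,b} = Σ_{i<r} λ_i v_i^{⊗n}  forces n ≤ r.  For n = 0
-- there is nothing to show; for r = 0 the entry at weight one gives b = 0.
-- Otherwise write v_0 = (α, β) for the first vector and split on β:
--
--  * β = 0:  v_0^{⊗(n+1)} is supported on the all-zero input, where M only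
--    records the free parameter a.  Dropping the first term therefore leaves a
--    decomposition of M_{n+1;a',b} with r terms, and n+1 ≤ r by induction.
--  * β ≠ 0:  contract the first tensor factor with the covector (β, -α).  This
--    annihilates v_0, maps each v^{⊗(n+1)} to a multiple of v^{⊗n} and maps
--    M_{n+1;a,b} to M_{n;βa-αb,βb}, with βb ≠ 0; so n ≤ r by induction.
--
-- Field equality is only a setoid, so "β = 0 or β ≠ 0" is not decidable; the
-- split is justified because the goal n+1 ≤ r+1 is decidable (byCases).

module Submission where

open import Defs
open import Data.Nat using (ℕ; zero; suc; _≤_; z≤n; s≤s; _≤?_)
open import Data.Nat.Properties using (m≤n⇒m≤1+n)
open import Data.Bool using (Bool; true; false)
open import Data.Vec using (Vec; []; _∷_; replicate)
open import Data.Fin using (Fin; zero; suc)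
open import Data.Product using (_×_; _,_; proj₁; proj₂; ∃)
open import Data.Sum using (_⊎_; inj₁; inj₂)
open import Data.Empty using (⊥-elim)
open import Relation.Nullary using (¬_; Dec)
open import Relation.Nullary.Decidable using (decidable-stable)
open import Relation.Binary.PropositionalEquality as ≡ using (_≡_)
import Algebra.Solver.Ring.NaturalCoefficients.Default as SemiringSolver
import Algebra.Properties.Ring as RingProperties
import Algebra.Properties.AbelianGroup as AbelianGroupProperties

-- A case distinction on an arbitrary (possibly undecidable) proposition P is
-- admissible when the goal G is decidable, since G is then ¬¬-stable.
byCases : ∀ {p g} {P : Set p} {G : Set g} → Dec G → (P → G) → (¬ P → G) → G
byCases G? onP on¬P = decidable-stable G? (λ ¬G → ¬G (on¬P (λ p → ¬G (onP p))))

weight-zeros : ∀ n → weight (replicate n false) ≡ 0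
weight-zeros zero    = ≡.refl
weight-zeros (suc n) = weight-zeros n

zeros-or-positive : ∀ {n} (x : Vec Bool n) →
                    x ≡ replicate n false ⊎ ∃ λ k → weight x ≡ suc k
zeros-or-positive []          = inj₁ ≡.refl
zeros-or-positive (true ∷ x)  = inj₂ (weight x , ≡.refl)
zeros-or-positive (false ∷ x) with zeros-or-positive x
... | inj₁ x≡0 = inj₁ (≡.cong (false ∷_) x≡0)
... | inj₂ pos = inj₂ pos

module SymmetricRank {c ℓ} (F : Field c ℓ) where
  open Field F hiding (zero)
  open import Relation.Binary.Reasoning.Setoid setoid
  open RingProperties ring using (-‿distribˡ-*)
  open AbelianGroupProperties +-abelianGroup using (xyx⁻¹≈y)
  open SemiringSolver commutativeSemiring using (solve; _:+_; _:*_; _:=_)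

  *-nonzero : ∀ {x y} → ¬ (x ≈ 0#) → ¬ (y ≈ 0#) → ¬ (x * y ≈ 0#)
  *-nonzero {x} {y} x≉0 y≉0 xy≈0 with inverse x x≉0
  ... | x⁻¹ , xx⁻¹≈1 = y≉0 (begin
    y                ≈⟨ *-identityˡ y ⟨
    1# * y           ≈⟨ *-congʳ xx⁻¹≈1 ⟨
    (x * x⁻¹) * y    ≈⟨ regroup x x⁻¹ y ⟩
    x⁻¹ * (x * y)    ≈⟨ *-congˡ xy≈0 ⟩
    x⁻¹ * 0#         ≈⟨ zeroʳ x⁻¹ ⟩
    0#               ∎)
    where
    regroup : ∀ u v w → (u * v) * w ≈ v * (u * w)
    regroup = solve 3 (λ u v w → (u :* v) :* w := v :* (u :* w)) refl

  annihilates : ∀ α β → β * α + (- α) * β ≈ 0#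
  annihilates α β = begin
    β * α + (- α) * β      ≈⟨ +-cong (*-comm β α) (sym (-‿distribˡ-* α β)) ⟩
    α * β + - (α * β)      ≈⟨ -‿inverseʳ (α * β) ⟩
    0#                     ∎

  ∑-cong : ∀ r {f g : Fin r → Carrier} → (∀ i → f i ≈ g i) → ∑ F r f ≈ ∑ F r g
  ∑-cong zero    f≈g = refl
  ∑-cong (suc r) f≈g = +-cong (f≈g zero) (∑-cong r (λ i → f≈g (suc i)))

  ∑-linear : ∀ r β γ (f g : Fin r → Carrier) →
             β * ∑ F r f + γ * ∑ F r g ≈ ∑ F r (λ i → β * f i + γ * g i)
  ∑-linear zero    β γ f g = trans (+-cong (zeroʳ β) (zeroʳ γ)) (+-identityʳ 0#)
  ∑-linear (suc r) β γ f g =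
    trans (split β γ _ _ _ _)
          (+-congˡ (∑-linear r β γ (λ i → f (suc i)) (λ i → g (suc i))))
    where
    split : ∀ β γ f₀ s g₀ t →
            β * (f₀ + s) + γ * (g₀ + t) ≈ (β * f₀ + γ * g₀) + (β * s + γ * t)
    split = solve 6 (λ β γ f₀ s g₀ t →
      β :* (f₀ :+ s) :+ γ :* (g₀ :+ t) := (β :* f₀ :+ γ :* g₀) :+ (β :* s :+ γ :* t)) refl

  profile : ℕ → Carrier → Carrier → Carrier
  profile zero          a b = a
  profile (suc zero)    a b = b
  profile (suc (suc _)) a b = 0#

  M-profile : ∀ n a b (x : Vec Bool n) → M F n a b x ≡ profile (weight x) a b
  M-profile n a b x with weight x
  ... | zero        = ≡.refl
  ... | suc zero    = ≡.refl
  ... | suc (suc _) = ≡.refl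

  M-at-zeros : ∀ n a b → M F n a b (replicate n false) ≡ a
  M-at-zeros n a b = ≡.trans (M-profile n a b (replicate n false))
                             (≡.cong (λ w → profile w a b) (weight-zeros n))

  M-at-unit : ∀ n a b → M F (suc n) a b (true ∷ replicate n false) ≡ b
  M-at-unit n a b = ≡.trans (M-profile (suc n) a b (true ∷ replicate n false))
                            (≡.cong (λ w → profile (suc w) a b) (weight-zeros n))

  M-independent-of-a : ∀ n a a' b (x : Vec Bool n) → ∃ (λ k → weight x ≡ suc k) →
                       M F n a b x ≡ M F n a' b x
  M-independent-of-a n a a' b x (k , wx≡1+k)
    rewrite M-profile n a b x | M-profile n a' b x | wx≡1+k = same k
    where
    same : ∀ k → profile (suc k) a b ≡ profile (suc k) a' b
    same zero    = ≡.refl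
    same (suc _) = ≡.refl

  decomp-resp : ∀ {n r} {A B : Tensor F n} → (∀ x → A x ≈ B x) →
                HasSymDecomp F n B r → HasSymDecomp F n A r
  decomp-resp A≈B (lam , v , B≈∑) = lam , v , (λ x → trans (A≈B x) (B≈∑ x))

  no-empty-decomp : ∀ {n a b} → ¬ (b ≈ 0#) → ¬ HasSymDecomp F (suc n) (M F (suc n) a b) 0
  no-empty-decomp {n} {a} {b} b≉0 (_ , _ , M≈0) =
    b≉0 (trans (reflexive (≡.sym (M-at-unit n a b))) (M≈0 (true ∷ replicate n false)))

  tensorPow-support : ∀ {n} α β (x : Vec Bool n) →
                      β ≈ 0# → ∃ (λ k → weight x ≡ suc k) →
                      tensorPow F n (α , β) x ≈ 0#
  tensorPow-support α β (true ∷ x)  β≈0 _   = trans (*-congʳ β≈0) (zeroˡ _)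
  tensorPow-support α β (false ∷ x) β≈0 pos =
    trans (*-congˡ (tensorPow-support α β x β≈0 pos)) (zeroʳ α)

  -- A first term supported on the all-zero input can be absorbed into a.
  drop-zero-supported : ∀ {n r a b} (lam : Fin (suc r) → Carrier)
    (v : Fin (suc r) → Carrier × Carrier) →
    (∀ x → M F n a b x ≈ ∑ F (suc r) (λ i → lam i * tensorPow F n (v i) x)) →
    proj₂ (v zero) ≈ 0# →
    HasSymDecomp F n (M F n (a + - (lam zero * tensorPow F n (v zero) (replicate n false))) b) r
  drop-zero-supported {n} {r} {a} {b} lam v M≈∑ β≈0 =
    (λ i → lam (suc i)) , (λ i → v (suc i)) , M'≈rest
    where
    first : Vec Bool n → Carrier
    first x = lam zero * tensorPow F n (v zero) x
    rest : Vec Bool n → Carrier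
    rest x = ∑ F r (λ i → lam (suc i) * tensorPow F n (v (suc i)) x)
    a' : Carrier
    a' = a + - first (replicate n false)

    M'≈rest : ∀ x → M F n a' b x ≈ rest x
    M'≈rest x with zeros-or-positive x
    ... | inj₁ ≡.refl = begin
      M F n a' b (replicate n false)  ≡⟨ M-at-zeros n a' b ⟩
      a + - first (replicate n false)
        ≈⟨ +-congʳ (trans (reflexive (≡.sym (M-at-zeros n a b))) (M≈∑ _)) ⟩
      first (replicate n false) + rest (replicate n false) + - first (replicate n false)
                                      ≈⟨ xyx⁻¹≈y _ _ ⟩
      rest (replicate n false)        ∎
    ... | inj₂ pos = begin
      M F n a' b x       ≡⟨ M-independent-of-a n a' a b x pos ⟩
      M F n a b x        ≈⟨ M≈∑ x ⟩
      first x + rest x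
        ≈⟨ +-congʳ (trans (*-congˡ (tensorPow-support _ _ x β≈0 pos)) (zeroʳ _)) ⟩
      0# + rest x        ≈⟨ +-identityˡ _ ⟩
      rest x             ∎

  contract : ∀ {n} → Carrier → Carrier → Tensor F (suc n) → Tensor F n
  contract β γ T x = β * T (false ∷ x) + γ * T (true ∷ x)

  contract-M : ∀ n a b β γ (x : Vec Bool n) →
               contract β γ (M F (suc n) a b) x ≈ M F n (β * a + γ * b) (β * b) x
  contract-M n a b β γ x
    rewrite M-profile (suc n) a b (false ∷ x) | M-profile (suc n) a b (true ∷ x)
          | M-profile n (β * a + γ * b) (β * b) x = on-profile (weight x)
    where
    on-profile : ∀ w → β * profile w a b + γ * profile (suc w) a b
                         ≈ profile w (β * a + γ * b) (β * b)
    on-profile zero          = refl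
    on-profile (suc zero)    = trans (+-congˡ (zeroʳ γ)) (+-identityʳ _)
    on-profile (suc (suc _)) = trans (+-cong (zeroʳ β) (zeroʳ γ)) (+-identityʳ 0#)

  contract-term : ∀ n β γ l (u : Carrier × Carrier) (x : Vec Bool n) →
                  contract β γ (λ y → l * tensorPow F (suc n) u y) x
                    ≈ (l * (β * proj₁ u + γ * proj₂ u)) * tensorPow F n u x
  contract-term n β γ l (α' , β') x = collect β γ l α' β' (tensorPow F n (α' , β') x)
    where
    collect : ∀ β γ l s t p →
              β * (l * (s * p)) + γ * (l * (t * p)) ≈ (l * (β * s + γ * t)) * p
    collect = solve 6 (λ β γ l s t p →
      β :* (l :* (s :* p)) :+ γ :* (l :* (t :* p)) := (l :* (β :* s :+ γ :* t)) :* p) refl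

  contract-first : ∀ {n r} {A : Tensor F (suc n)} (lam : Fin (suc r) → Carrier)
    (v : Fin (suc r) → Carrier × Carrier) →
    (∀ x → A x ≈ ∑ F (suc r) (λ i → lam i * tensorPow F (suc n) (v i) x)) →
    HasSymDecomp F n (contract (proj₂ (v zero)) (- proj₁ (v zero)) A) r
  contract-first {n} {r} {A} lam v A≈∑ =
    (λ i → coeff (suc i)) , (λ i → v (suc i)) , contracted
    where
    β γ : Carrier
    β = proj₂ (v zero)
    γ = - proj₁ (v zero)
    coeff : Fin (suc r) → Carrier
    coeff i = lam i * (β * proj₁ (v i) + γ * proj₂ (v i))
    summand : Fin (suc r) → Tensor F (suc n)
    summand i y = lam i * tensorPow F (suc n) (v i) y
    term : Fin (suc r) → Tensor F n
    term i x = coeff i * tensorPow F n (v i) x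

    first-vanishes : ∀ x → term zero x ≈ 0#
    first-vanishes x = trans (*-congʳ (trans (*-congˡ (annihilates _ _)) (zeroʳ _))) (zeroˡ _)

    contracted : ∀ x → contract β γ A x ≈ ∑ F r (λ i → term (suc i) x)
    contracted x = begin
      contract β γ A x
        ≈⟨ +-cong (*-congˡ (A≈∑ (false ∷ x))) (*-congˡ (A≈∑ (true ∷ x))) ⟩
      contract β γ (λ y → ∑ F (suc r) (λ i → summand i y)) x
        ≈⟨ ∑-linear (suc r) β γ (λ i → summand i (false ∷ x)) (λ i → summand i (true ∷ x)) ⟩
      ∑ F (suc r) (λ i → contract β γ (summand i) x)
        ≈⟨ ∑-cong (suc r) (λ i → contract-term n β γ (lam i) (v i) x) ⟩
      term zero x + ∑ F r (λ i → term (suc i) x)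
        ≈⟨ +-congʳ (first-vanishes x) ⟩
      0# + ∑ F r (λ i → term (suc i) x)
        ≈⟨ +-identityˡ _ ⟩
      ∑ F r (λ i → term (suc i) x) ∎

  rank-bound : ∀ {n a b} r → ¬ (b ≈ 0#) → HasSymDecomp F n (M F n a b) r → n ≤ r
  rank-bound {zero}  r       _   _ = z≤n
  rank-bound {suc n} zero    b≉0 d = ⊥-elim (no-empty-decomp b≉0 d)
  rank-bound {suc n} {a} {b} (suc r) b≉0 (lam , v , M≈∑) =
    byCases (suc n ≤? suc r) supportedAtZeros contractible
    where
    α β : Carrier
    α = proj₁ (v zero)
    β = proj₂ (v zero)

    supportedAtZeros : β ≈ 0# → suc n ≤ suc r
    supportedAtZeros β≈0 =
      m≤n⇒m≤1+n (rank-bound r b≉0 (drop-zero-supported lam v M≈∑ β≈0))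

    contractible : ¬ (β ≈ 0#) → suc n ≤ suc r
    contractible β≉0 =
      s≤s (rank-bound r (*-nonzero β≉0 b≉0)
             (decomp-resp (λ x → sym (contract-M n a b β (- α) x))
                          (contract-first lam v M≈∑)))

lemma4p1 : ∀ {c ℓ} (F : Field c ℓ) (a b : Field.Carrier F) →
    ¬ (Field._≈_ F b (Field.0# F)) → (n : ℕ) →
    SymRankAtLeast F n (M F n a b) n
lemma4p1 F a b b≉0 n r decomposition = SymmetricRank.rank-bound F r b≉0 decomposition
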